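{- For every integer $n\ge 2$, $$P(2,\underbrace{1,1,\ldots,1}_{n-2})=d(n)-2d(n-1)-d(n-2).$$
   Context: For pairwise disjoint finite sets $T_1,\dots,T_r$ with $|T_i|=t_i$, a generalized derangement (GD) is a permutation $\sigma$ of $\bigcup_{i=1}^r T_i$ such that $\sigma(a)\notin T_i$ for every $i$ and every $a\in T_i$; $P(t_1,\dots,t_r)$ denotes the number of GDs. $d(m)$ is the number of derangements (fixed-point-free permutations) of an $m$-element set, with $d(0)=1$. -}

module Defs where

open import Data.Nat using (ℕ; zero; suc; _≟_)
open import Data.Fin using (Fin; splitAt) renaming (_≟_ to _≟ᶠ_)
open import Data.Fin.Properties using (all?; any?)
open import Data.List using (allFin; List; []; _∷_; [_]; map; concatMap; filter; length)
open import Data.Nat.ListAction using (sum)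
open import Data.Product using (∃; _×_)
open import Data.Sum using (inj₁; inj₂)
open import Function using (_∘_)
open import Relation.Binary.PropositionalEquality using (_≡_; _≢_)
open import Relation.Nullary using (Dec; ¬?; _×-dec_; _→-dec_)
open import Data.Fin using () renaming (zero to fzero; suc to fsuc)

allFuns : (k n : ℕ) → List (Fin k → Fin n)
allFuns zero    n = [ (λ ()) ]
allFuns (suc k) n =
  concatMap (λ f → map (λ y → λ { fzero → y ; (fsuc i) → f i }) (allFin n)) (allFuns k n)

IsPerm : {m : ℕ} → (Fin m → Fin m) → Set
IsPerm {m} σ = (∀ i j → σ i ≡ σ j → i ≡ j) × (∀ y → ∃ λ x → σ x ≡ y)

isPerm? : {m : ℕ} → (σ : Fin m → Fin m) → Dec (IsPerm σ)
isPerm? σ = all? (λ i → all? (λ j → (σ i ≟ᶠ σ j) →-dec (i ≟ᶠ j)))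
            ×-dec all? (λ y → any? (λ x → σ x ≟ᶠ y))

countPerms : (m : ℕ) {Q : (Fin m → Fin m) → Set} →
             ((σ : Fin m → Fin m) → Dec (Q σ)) → ℕ
countPerms m Q? = length (filter (λ σ → isPerm? σ ×-dec Q? σ) (allFuns m m))

-- d(m): number of derangements of an m-element set (d 0 = 1).
IsFixedPointFree : {m : ℕ} → (Fin m → Fin m) → Set
IsFixedPointFree σ = ∀ a → σ a ≢ a

d : ℕ → ℕ
d m = countPerms m {IsFixedPointFree} (λ σ → all? (λ a → ¬? (σ a ≟ᶠ a)))

-- The ground set for sizes ts = (t₁,…,t_r) is Fin (t₁ + … + t_r), partitioned
-- into consecutive blocks T₁,…,T_r of sizes t₁,…,t_r; block ts a is the
-- (0-based) index i of the block containing a.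
block : (ts : List ℕ) → Fin (sum ts) → ℕ
block []       ()
block (t ∷ ts) a with splitAt t a
... | inj₁ _ = 0
... | inj₂ b = suc (block ts b)

IsGD : (ts : List ℕ) → (Fin (sum ts) → Fin (sum ts)) → Set
IsGD ts σ = ∀ a → block ts (σ a) ≢ block ts a

P : List ℕ → ℕ
P ts = countPerms (sum ts) {IsGD ts} (λ σ → all? (λ a → ¬? (block ts (σ a) ≟ block ts a)))

-- Write n = k + 2 and let the block of size 2 be {0,1}.  A generalized
-- derangement for (2,1,…,1) is exactly a derangement σ of Fin (k+2) with
-- σ(0) ≠ 1 and σ(1) ≠ 0.  Splitting all derangements of Fin (k+2) according
-- to whether σ(0) = 1 and whether σ(1) = 0 gives four classes:
--   * σ(0) = 1, σ(1) = 0  — forgetting the 2-cycle (0 1) leaves a derangement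
--                           of the other k points: d(k) of them;
--   * σ(0) = 1, σ(1) ≠ 0  — removing 0 from its cycle gives a derangement of
--                           k+1 points, and conversely: d(k+1) of them;
--   * σ(0) ≠ 1, σ(1) = 0  — conjugation by the transposition (0 1) maps this
--                           class onto the previous one: d(k+1) of them;
--   * σ(0) ≠ 1, σ(1) ≠ 0  — the generalized derangements: P(2,1,…,1).
-- Hence d(k+2) = d(k) + 2·d(k+1) + P(2,1,…,1).
module Submission where

open import Defs
open import Level using (Level; 0ℓ)
open import Data.Nat using (ℕ; zero; suc; _+_; _≤_; _∸_; s≤s)
open import Data.Nat.Properties using (+-assoc; +-commutativeSemigroup)
  renaming (suc-injective to ℕ-suc-injective)
open import Algebra.Properties.CommutativeSemigroup +-commutativeSemigroup
  using (interchange)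
open import Data.Fin using (Fin; suc; toℕ; _↑ʳ_; punchIn; pinch)
open import Data.Fin.Patterns using (0F; 1F)
open import Data.Fin.Properties
  using (_≟_; all?; suc-injective; toℕ-injective; punchIn-injective; punchInᵢ≢i)
open import Data.List using (List; []; _∷_; _++_; map; concatMap; filter; length; allFin; replicate)
open import Data.List.Membership.Propositional using (_∈_)
open import Data.List.Membership.Propositional.Properties using (∈-allFin)
open import Data.List.Relation.Unary.All as All using (All; []; _∷_)
open import Data.List.Relation.Unary.Any using (here; there)
open import Data.List.Relation.Unary.AllPairs using (_∷_)
open import Data.List.Relation.Unary.Unique.Propositional using (Unique)
open import Data.List.Relation.Unary.Unique.Propositional.Properties using (allFin⁺)
open import Data.Nat.ListAction using (sum)
open import Data.Product using (_×_; _,_; ∃)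
open import Function using (_∘_)
open import Relation.Binary.Definitions using (DecidableEquality)
open import Relation.Binary.PropositionalEquality
open import Relation.Nullary using (Dec; yes; no; ¬?; _×-dec_; contradiction)
open import Relation.Unary using (Pred; Decidable; _∩_; ∁)
open import Relation.Unary.Properties using (_∩?_; ∁?)

private variable
  a b : Level
  A : Set a
  B : Set b
  k n k′ n′ m : ℕ

indicator : {P : Set a} → Dec P → ℕ
indicator (yes _) = 1
indicator (no _)  = 0

sumOver : (A → ℕ) → List A → ℕ
sumOver f []       = 0
sumOver f (x ∷ xs) = f x + sumOver f xs

count : {P : Pred A b} → Decidable P → List A → ℕ
count P? = sumOver (indicator ∘ P?)

length-filter≡count : {P : Pred A b} (P? : Decidable P) (xs : List A) →
                      length (filter P? xs) ≡ count P? xs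
length-filter≡count P? []       = refl
length-filter≡count P? (x ∷ xs) with P? x
... | yes _ = cong suc (length-filter≡count P? xs)
... | no _  = length-filter≡count P? xs

sumOver-cong : {f g : A → ℕ} → f ≗ g → (xs : List A) → sumOver f xs ≡ sumOver g xs
sumOver-cong f≗g []       = refl
sumOver-cong f≗g (x ∷ xs) = cong₂ _+_ (f≗g x) (sumOver-cong f≗g xs)

sumOver-+ : (f g : A → ℕ) (xs : List A) →
            sumOver (λ x → f x + g x) xs ≡ sumOver f xs + sumOver g xs
sumOver-+ f g []       = refl
sumOver-+ f g (x ∷ xs) = trans (cong (f x + g x +_) (sumOver-+ f g xs))
                               (interchange (f x) (g x) (sumOver f xs) (sumOver g xs))

sumOver-zero : (xs : List A) → sumOver (λ _ → 0) xs ≡ 0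
sumOver-zero []       = refl
sumOver-zero (x ∷ xs) = sumOver-zero xs

sumOver-swap : (F : A → B → ℕ) (xs : List A) (ys : List B) →
  sumOver (λ x → sumOver (F x) ys) xs ≡ sumOver (λ y → sumOver (λ x → F x y) xs) ys
sumOver-swap F []       ys = sym (sumOver-zero ys)
sumOver-swap F (x ∷ xs) ys =
  trans (cong (sumOver (F x) ys +_) (sumOver-swap F xs ys))
        (sym (sumOver-+ (F x) (λ y → sumOver (λ x → F x y) xs) ys))

count-cong : {P Q : Pred A b} (P? : Decidable P) (Q? : Decidable Q) →
             (∀ x → P x → Q x) → (∀ x → Q x → P x) →
             (xs : List A) → count P? xs ≡ count Q? xs
count-cong P? Q? P⇒Q Q⇒P = sumOver-cong (λ x → agree (P? x) (Q? x) (P⇒Q x) (Q⇒P x))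
  where
  agree : {X Y : Set b} (x? : Dec X) (y? : Dec Y) → (X → Y) → (Y → X) →
          indicator x? ≡ indicator y?
  agree (yes _) (yes _) _   _   = refl
  agree (yes x) (no ¬y) x⇒y _   = contradiction (x⇒y x) ¬y
  agree (no ¬x) (yes y) _   y⇒x = contradiction (y⇒x y) ¬x
  agree (no _)  (no _)  _   _   = refl

count-none : {P : Pred A b} (P? : Decidable P) (xs : List A) →
             All (∁ P) xs → count P? xs ≡ 0
count-none P? []       []          = refl
count-none P? (x ∷ xs) (¬px ∷ ¬ps) with P? x
... | yes px = contradiction px ¬px
... | no _   = count-none P? xs ¬ps

count-split : {P R : Pred A b} (P? : Decidable P) (R? : Decidable R) (xs : List A) →
              count P? xs ≡ count (P? ∩? R?) xs + count (P? ∩? ∁? R?) xs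
count-split P? R? xs =
  trans (sumOver-cong (λ x → split (P? x) (R? x)) xs) (sumOver-+ _ _ xs)
  where
  split : {X Y : Set b} (x? : Dec X) (y? : Dec Y) →
          indicator x? ≡ indicator (x? ×-dec y?) + indicator (x? ×-dec ¬? y?)
  split (yes _) (yes _) = refl
  split (yes _) (no _)  = refl
  split (no _)  _       = refl

count-++ : {P : Pred A b} (P? : Decidable P) (xs ys : List A) →
           count P? (xs ++ ys) ≡ count P? xs + count P? ys
count-++ P? []       ys = refl
count-++ P? (x ∷ xs) ys =
  trans (cong (indicator (P? x) +_) (count-++ P? xs ys))
        (sym (+-assoc (indicator (P? x)) _ _))

count-concatMap : {P : Pred B b} (P? : Decidable P) (G : A → List B) (xs : List A) →
                  count P? (concatMap G xs) ≡ sumOver (count P? ∘ G) xs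
count-concatMap P? G []       = refl
count-concatMap P? G (x ∷ xs) =
  trans (count-++ P? (G x) (concatMap G xs))
        (cong (count P? (G x) +_) (count-concatMap P? G xs))

count-map : {P : Pred B b} (P? : Decidable P) (h : A → B) (xs : List A) →
            count P? (map h xs) ≡ count (P? ∘ h) xs
count-map P? h []       = refl
count-map P? h (x ∷ xs) = cong (indicator (P? (h x)) +_) (count-map P? h xs)

count-unique : (eq? : DecidableEquality A) {c : A} {xs : List A} →
               Unique xs → c ∈ xs → count (λ y → eq? y c) xs ≡ 1
count-unique eq? {c} {x ∷ xs} (x∉xs ∷ unique) c∈ with eq? x c
... | yes refl = cong suc (count-none (λ y → eq? y x) xs (All.map (λ x≢y y≡x → x≢y (sym y≡x)) x∉xs))
... | no x≢c with c∈
...   | here c≡x    = contradiction (sym c≡x) x≢c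
...   | there c∈xs = count-unique eq? unique c∈xs

_≗?_ : (f g : Fin k → Fin n) → Dec (f ≗ g)
f ≗? g = all? (λ i → f i ≟ g i)

count-extensions : (f : Fin k → Fin n) (h : Fin (suc k) → Fin n)
  (extend : Fin n → Fin (suc k) → Fin n) →
  (∀ y → extend y 0F ≡ y) → (∀ y i → extend y (suc i) ≡ f i) →
  count (λ y → extend y ≗? h) (allFin n) ≡ indicator (f ≗? (h ∘ suc))
count-extensions {n = n} f h extend extend-0 extend-suc with f ≗? (h ∘ suc)
... | yes f≗h = trans
        (count-cong (λ y → extend y ≗? h) (λ y → y ≟ h 0F)
          (λ y ext≗h → trans (sym (extend-0 y)) (ext≗h 0F))
          (λ y y≡h0 → λ { 0F → trans (extend-0 y) y≡h0
                        ; (suc i) → trans (extend-suc y i) (f≗h i) })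
          (allFin n))
        (count-unique _≟_ (allFin⁺ n) (∈-allFin (h 0F)))
... | no f≉h = count-none (λ y → extend y ≗? h) (allFin n)
        (All.tabulate (λ {y} _ ext≗h → f≉h (λ i → trans (sym (extend-suc y i)) (ext≗h (suc i)))))

allFuns-unique : ∀ k n (h : Fin k → Fin n) → count (_≗? h) (allFuns k n) ≡ 1
allFuns-unique zero    n h = refl
allFuns-unique (suc k) n h =
  trans (count-concatMap (_≗? h) _ (allFuns k n))
  (trans (sumOver-cong (λ f → trans (count-map (_≗? h) _ (allFin n))
                                    (count-extensions f h _ (λ _ → refl) (λ _ _ → refl)))
                       (allFuns k n))
         (allFuns-unique k n (h ∘ suc)))

Respects≗ : Pred (Fin k → Fin n) 0ℓ → Set
Respects≗ Q = ∀ {σ τ} → σ ≗ τ → Q σ → Q τ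

record Correspondence (Q : Pred (Fin k → Fin n) 0ℓ) (Q′ : Pred (Fin k′ → Fin n′) 0ℓ) : Set where
  field
    to             : (Fin k → Fin n) → (Fin k′ → Fin n′)
    from           : (Fin k′ → Fin n′) → (Fin k → Fin n)
    to-cong        : ∀ {σ τ} → σ ≗ τ → to σ ≗ to τ
    from-cong      : ∀ {σ τ} → σ ≗ τ → from σ ≗ from τ
    to-preserves   : ∀ σ → Q σ → Q′ (to σ)
    from-preserves : ∀ τ → Q′ τ → Q (from τ)
    from∘to        : ∀ σ → Q σ → from (to σ) ≗ σ
    to∘from        : ∀ τ → Q′ τ → to (from τ) ≗ τ

count-graph : {Q : Pred A 0ℓ} (Q? : Decidable Q) (F : A → Fin k → Fin n) (xs : List A) →
  sumOver (λ x → count (λ τ → Q? x ×-dec (τ ≗? F x)) (allFuns k n)) xs ≡ count Q? xs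
count-graph {k = k} {n = n} {Q = Q} Q? F = sumOver-cong (λ x → fibre x (Q? x))
  where
  fibre : ∀ x (q? : Dec (Q x)) → count (λ τ → q? ×-dec (τ ≗? F x)) (allFuns k n) ≡ indicator q?
  fibre x (yes q) = trans (count-cong _ (_≗? F x) (λ _ (_ , e) → e) (λ _ e → q , e) (allFuns k n))
                          (allFuns-unique k n (F x))
  fibre x (no ¬q) = count-none (λ τ → no ¬q ×-dec (τ ≗? F x)) (allFuns k n)
                                 (All.tabulate (λ _ (q , _) → ¬q q))

-- The bijection principle, proved by double counting the pairs (σ, τ) with
-- σ ∈ Q and τ ≗ to σ, equivalently τ ∈ Q′ and σ ≗ from τ.
count-correspondence : {Q : Pred (Fin k → Fin n) 0ℓ} {Q′ : Pred (Fin k′ → Fin n′) 0ℓ} →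
  Respects≗ Q → Respects≗ Q′ → Correspondence Q Q′ →
  (Q? : Decidable Q) (Q′? : Decidable Q′) →
  count Q? (allFuns k n) ≡ count Q′? (allFuns k′ n′)
count-correspondence {k = k} {n = n} {k′ = k′} {n′ = n′} {Q} {Q′} Q-resp Q′-resp corr Q? Q′? =
  trans (sym (count-graph Q? to X))
  (trans (sumOver-swap (λ σ τ → indicator (Q? σ ×-dec (τ ≗? to σ))) X Y)
  (trans (sumOver-cong (λ τ → count-cong _ _ (forth τ) (back τ) X) Y)
         (count-graph Q′? from Y)))
  where
  open Correspondence corr
  X = allFuns k n
  Y = allFuns k′ n′
  forth : ∀ τ σ → Q σ × τ ≗ to σ → Q′ τ × σ ≗ from τ
  forth τ σ (q , τ≗) = Q′-resp (λ i → sym (τ≗ i)) (to-preserves σ q)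
                     , (λ i → trans (sym (from∘to σ q i)) (from-cong (λ j → sym (τ≗ j)) i))
  back : ∀ τ σ → Q′ τ × σ ≗ from τ → Q σ × τ ≗ to σ
  back τ σ (q′ , σ≗) = Q-resp (λ i → sym (σ≗ i)) (from-preserves τ q′)
                     , (λ i → trans (sym (to∘from τ q′ i)) (to-cong (λ j → sym (σ≗ j)) i))

Endo : ℕ → Set
Endo m = Fin m → Fin m

IsDerangement : Pred (Endo m) 0ℓ
IsDerangement σ = IsPerm σ × IsFixedPointFree σ

derangement? : Decidable (IsDerangement {m})
derangement? σ = isPerm? σ ×-dec all? (λ a → ¬? (σ a ≟ a))

d≡count : ∀ m → d m ≡ count derangement? (allFuns m m)
d≡count m = length-filter≡count derangement? (allFuns m m)

Maps : Fin m → Fin m → Pred (Endo m) 0ℓ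
Maps i j σ = σ i ≡ j

maps? : (i j : Fin m) → Decidable (Maps i j)
maps? i j σ = σ i ≟ j

derangement-respects : Respects≗ (IsDerangement {m})
derangement-respects σ≗τ ((inj , surj) , fpf) =
  ( (λ i j τi≡τj → inj i j (trans (σ≗τ i) (trans τi≡τj (sym (σ≗τ j)))))
  , (λ y → let (x , σx≡y) = surj y in x , trans (sym (σ≗τ x)) σx≡y) )
  , (λ a τa≡a → fpf a (trans (σ≗τ a) τa≡a))

maps-respects : (i j : Fin m) → Respects≗ (Maps i j)
maps-respects i j σ≗τ σi≡j = trans (sym (σ≗τ i)) σi≡j

∩-respects : {Q R : Pred (Fin k → Fin n) 0ℓ} → Respects≗ Q → Respects≗ R → Respects≗ (Q ∩ R)
∩-respects Q-resp R-resp σ≗τ (q , r) = Q-resp σ≗τ q , R-resp σ≗τ r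

∁-respects : {Q : Pred (Fin k → Fin n) 0ℓ} → Respects≗ Q → Respects≗ (∁ Q)
∁-respects Q-resp σ≗τ ¬q q = ¬q (Q-resp (λ i → sym (σ≗τ i)) q)

perm-unique : {σ : Endo m} → IsPerm σ → ∀ {i j x} → σ i ≡ j → σ x ≡ j → x ≡ i
perm-unique (inj , _) σi≡j σx≡j = inj _ _ (trans σx≡j (sym σi≡j))

SwapsZeroOne : Pred (Endo (2 + k)) 0ℓ
SwapsZeroOne = (IsDerangement ∩ Maps 0F 1F) ∩ Maps 1F 0F

swapsZeroOne? : Decidable (SwapsZeroOne {k})
swapsZeroOne? = (derangement? ∩? maps? 0F 1F) ∩? maps? 1F 0F

-- y − 2 for y ≥ 2; the fallback value x is never used on SwapsZeroOne.
lower₂ : Fin (2 + k) → Fin k → Fin k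
lower₂ 0F            x = x
lower₂ 1F            x = x
lower₂ (suc (suc y)) _ = y

restrict₂ : Endo (2 + k) → Endo k
restrict₂ σ x = lower₂ (σ (suc (suc x))) x

extend₂ : Endo k → Endo (2 + k)
extend₂ τ 0F            = 1F
extend₂ τ 1F            = 0F
extend₂ τ (suc (suc x)) = suc (suc (τ x))

restrict₂-spec : {σ : Endo (2 + k)} → SwapsZeroOne σ →
                 ∀ x → σ (suc (suc x)) ≡ suc (suc (restrict₂ σ x))
restrict₂-spec {σ = σ} (((perm , _) , σ0≡1) , σ1≡0) x with σ (suc (suc x)) in σx≡
... | 0F          = contradiction (perm-unique perm σ1≡0 σx≡) λ ()
... | 1F          = contradiction (perm-unique perm σ0≡1 σx≡) λ ()
... | suc (suc y) = refl

restrict₂-derangement : {σ : Endo (2 + k)} → SwapsZeroOne σ → IsDerangement (restrict₂ σ)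
restrict₂-derangement {σ = σ} swaps@((((inj , surj) , fpf) , σ0≡1) , σ1≡0) =
  (injective , surjective) , fixedPointFree
  where
  spec : ∀ x → σ (suc (suc x)) ≡ suc (suc (restrict₂ σ x))
  spec = restrict₂-spec swaps
  injective : ∀ i j → restrict₂ σ i ≡ restrict₂ σ j → i ≡ j
  injective i j e = suc-injective (suc-injective
    (inj _ _ (trans (spec i) (trans (cong (2 ↑ʳ_) e) (sym (spec j))))))
  surjective : ∀ y → ∃ λ x → restrict₂ σ x ≡ y
  surjective y with surj (suc (suc y))
  ... | 0F          , σ0≡ = contradiction (trans (sym σ0≡1) σ0≡) λ ()
  ... | 1F          , σ1≡ = contradiction (trans (sym σ1≡0) σ1≡) λ ()
  ... | suc (suc x) , σx≡ = x , suc-injective (suc-injective (trans (sym (spec x)) σx≡))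
  fixedPointFree : ∀ x → restrict₂ σ x ≢ x
  fixedPointFree x e = fpf _ (trans (spec x) (cong (2 ↑ʳ_) e))

extend₂-swapsZeroOne : {τ : Endo k} → IsDerangement τ → SwapsZeroOne (extend₂ τ)
extend₂-swapsZeroOne {τ = τ} ((inj , surj) , fpf) =
  (((injective , surjective) , fixedPointFree) , refl) , refl
  where
  injective : ∀ i j → extend₂ τ i ≡ extend₂ τ j → i ≡ j
  injective 0F            0F            _ = refl
  injective 1F            1F            _ = refl
  injective (suc (suc i)) (suc (suc j)) e =
    cong (2 ↑ʳ_) (inj i j (suc-injective (suc-injective e)))
  injective 0F            1F            ()
  injective 0F            (suc (suc j)) ()
  injective 1F            0F            ()
  injective 1F            (suc (suc j)) ()
  injective (suc (suc i)) 0F            ()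
  injective (suc (suc i)) 1F            ()
  surjective : ∀ y → ∃ λ x → extend₂ τ x ≡ y
  surjective 0F            = 1F , refl
  surjective 1F            = 0F , refl
  surjective (suc (suc y)) = let (x , τx≡y) = surj y in suc (suc x) , cong (2 ↑ʳ_) τx≡y
  fixedPointFree : ∀ x → extend₂ τ x ≢ x
  fixedPointFree 0F            ()
  fixedPointFree 1F            ()
  fixedPointFree (suc (suc x)) e = fpf x (suc-injective (suc-injective e))

extend₂-restrict₂ : {σ : Endo (2 + k)} → SwapsZeroOne σ → extend₂ (restrict₂ σ) ≗ σ
extend₂-restrict₂ ((_ , σ0≡1) , _)     0F            = sym σ0≡1
extend₂-restrict₂ (_ , σ1≡0)           1F            = sym σ1≡0
extend₂-restrict₂ swaps                (suc (suc x)) = sym (restrict₂-spec swaps x)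

count-swapsZeroOne : ∀ k → count swapsZeroOne? (allFuns (2 + k) (2 + k)) ≡ d k
count-swapsZeroOne k =
  trans (count-correspondence
          (∩-respects (∩-respects derangement-respects (maps-respects 0F 1F)) (maps-respects 1F 0F))
          derangement-respects correspondence swapsZeroOne? derangement?)
        (sym (d≡count k))
  where
  correspondence : Correspondence (SwapsZeroOne {k}) (IsDerangement {k})
  correspondence = record
    { to             = restrict₂
    ; from           = extend₂
    ; to-cong        = λ σ≗τ x → cong (λ y → lower₂ y x) (σ≗τ (suc (suc x)))
    ; from-cong      = λ { σ≗τ 0F → refl ; σ≗τ 1F → refl
                         ; σ≗τ (suc (suc x)) → cong (2 ↑ʳ_) (σ≗τ x) }
    ; to-preserves   = λ _ → restrict₂-derangement
    ; from-preserves = λ _ → extend₂-swapsZeroOne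
    ; from∘to        = λ _ → extend₂-restrict₂
    ; to∘from        = λ _ _ _ → refl
    }

ZeroToOneOnly : Pred (Endo (2 + k)) 0ℓ
ZeroToOneOnly = (IsDerangement ∩ Maps 0F 1F) ∩ ∁ (Maps 1F 0F)

zeroToOneOnly? : Decidable (ZeroToOneOnly {k})
zeroToOneOnly? = (derangement? ∩? maps? 0F 1F) ∩? ∁? (maps? 1F 0F)

-- Removing the point 0 from its cycle … → a → 0 → 1 → … (so that a ↦ 1) and
-- renumbering 1, …, k+1 as 0, …, k.  The renumbering of values is pinch 0F,
-- which merges 0 and 1; only 1 occurs as a value, since σ(0) = 1.
removeZero : Endo (2 + k) → Endo (1 + k)
removeZero σ x = pinch 0F (σ (suc x))

-- The inverse operation: renumber 0, …, k as 1, …, k+1 and insert a new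
-- point 0 just before 1 in its cycle (the values of τ are renumbered by
-- punchIn 1F, which skips 1, so the point that mapped to what is now 1
-- maps to 0 instead).
insertZero : Endo (1 + k) → Endo (2 + k)
insertZero τ 0F      = 1F
insertZero τ (suc x) = punchIn 1F (τ x)

pinch-punchIn₁ : (y : Fin (1 + k)) → pinch 0F (punchIn 1F y) ≡ y
pinch-punchIn₁ 0F      = refl
pinch-punchIn₁ (suc y) = refl

punchIn₁-pinch : (y : Fin (2 + k)) → y ≢ 1F → punchIn 1F (pinch 0F y) ≡ y
punchIn₁-pinch 0F            _   = refl
punchIn₁-pinch 1F            y≢1 = contradiction refl y≢1
punchIn₁-pinch (suc (suc y)) _   = refl

removeZero-recover : {σ : Endo (2 + k)} → IsPerm σ → Maps 0F 1F σ →
                     ∀ x → punchIn 1F (removeZero σ x) ≡ σ (suc x)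
removeZero-recover {σ = σ} perm σ0≡1 x =
  punchIn₁-pinch (σ (suc x)) (λ σx≡1 → contradiction (perm-unique perm σ0≡1 σx≡1) λ ())

removeZero-derangement : {σ : Endo (2 + k)} → ZeroToOneOnly σ → IsDerangement (removeZero σ)
removeZero-derangement {σ = σ} ((((inj , surj) , fpf) , σ0≡1) , σ1≢0) =
  (injective , surjective) , fixedPointFree
  where
  recover : ∀ x → punchIn 1F (removeZero σ x) ≡ σ (suc x)
  recover = removeZero-recover (inj , surj) σ0≡1
  injective : ∀ i j → removeZero σ i ≡ removeZero σ j → i ≡ j
  injective i j e = suc-injective
    (inj _ _ (trans (sym (recover i)) (trans (cong (punchIn 1F) e) (recover j))))
  surjective : ∀ y → ∃ λ x → removeZero σ x ≡ y
  surjective y with surj (punchIn 1F y)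
  ... | 0F    , σ0≡ = contradiction (trans (sym σ0≡) σ0≡1) (punchInᵢ≢i 1F y)
  ... | suc x , σx≡ = x , trans (cong (pinch 0F) σx≡) (pinch-punchIn₁ y)
  -- A fixed point x of removeZero σ would give σ(x+1) = punchIn 1F x.
  notShifted : ∀ x → σ (suc x) ≢ punchIn 1F x
  notShifted 0F      = σ1≢0
  notShifted (suc x) = fpf (suc (suc x))
  fixedPointFree : ∀ x → removeZero σ x ≢ x
  fixedPointFree x e = notShifted x (trans (sym (recover x)) (cong (punchIn 1F) e))

insertZero-zeroToOneOnly : {τ : Endo (1 + k)} → IsDerangement τ → ZeroToOneOnly (insertZero τ)
insertZero-zeroToOneOnly {τ = τ} ((inj , surj) , fpf) =
  (((injective , surjective) , fixedPointFree) , refl) , (λ e → fpf 0F (lowered 0F e))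
  where
  lowered : ∀ x {y} → punchIn 1F (τ x) ≡ y → τ x ≡ pinch 0F y
  lowered x e = trans (sym (pinch-punchIn₁ (τ x))) (cong (pinch 0F) e)
  injective : ∀ i j → insertZero τ i ≡ insertZero τ j → i ≡ j
  injective 0F      0F      _ = refl
  injective 0F      (suc j) e = contradiction (sym e) (punchInᵢ≢i 1F (τ j))
  injective (suc i) 0F      e = contradiction e (punchInᵢ≢i 1F (τ i))
  injective (suc i) (suc j) e = cong suc (inj i j (punchIn-injective 1F _ _ e))
  hit : ∀ y → y ≢ 1F → ∃ λ x → insertZero τ x ≡ y
  hit y y≢1 = let (x , τx≡) = surj (pinch 0F y)
              in suc x , trans (cong (punchIn 1F) τx≡) (punchIn₁-pinch y y≢1)
  surjective : ∀ y → ∃ λ x → insertZero τ x ≡ y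
  surjective 0F            = hit 0F λ ()
  surjective 1F            = 0F , refl
  surjective (suc (suc y)) = hit (suc (suc y)) λ ()
  fixedPointFree : ∀ x → insertZero τ x ≢ x
  fixedPointFree 0F      ()
  fixedPointFree (suc x) e = fpf x (lowered x e)

count-zeroToOneOnly : ∀ k → count zeroToOneOnly? (allFuns (2 + k) (2 + k)) ≡ d (1 + k)
count-zeroToOneOnly k =
  trans (count-correspondence
          (∩-respects (∩-respects derangement-respects (maps-respects 0F 1F))
                      (∁-respects (maps-respects 1F 0F)))
          derangement-respects correspondence zeroToOneOnly? derangement?)
        (sym (d≡count (1 + k)))
  where
  correspondence : Correspondence (ZeroToOneOnly {k}) (IsDerangement {1 + k})
  correspondence = record
    { to             = removeZero
    ; from           = insertZero
    ; to-cong        = λ σ≗τ x → cong (pinch 0F) (σ≗τ (suc x))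
    ; from-cong      = λ { σ≗τ 0F → refl ; σ≗τ (suc x) → cong (punchIn 1F) (σ≗τ x) }
    ; to-preserves   = λ _ → removeZero-derangement
    ; from-preserves = λ _ → insertZero-zeroToOneOnly
    ; from∘to        = λ { σ (((perm , _) , σ0≡1) , _) 0F → sym σ0≡1
                         ; σ (((perm , _) , σ0≡1) , _) (suc x) → removeZero-recover perm σ0≡1 x }
    ; to∘from        = λ τ _ x → pinch-punchIn₁ (τ x)
    }

module Conjugation {t : Endo m} (t-involutive : ∀ x → t (t x) ≡ x) where

  conjugate : Endo m → Endo m
  conjugate σ = t ∘ σ ∘ t

  move : ∀ {x y} → t x ≡ y → x ≡ t y
  move {x} tx≡y = trans (sym (t-involutive x)) (cong t tx≡y)

  t-injective : ∀ {x y} → t x ≡ t y → x ≡ y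
  t-injective {y = y} tx≡ty = trans (move tx≡ty) (t-involutive y)

  conjugate-derangement : {σ : Endo m} → IsDerangement σ → IsDerangement (conjugate σ)
  conjugate-derangement {σ} ((inj , surj) , fpf) =
    ( (λ i j e → t-injective (inj _ _ (t-injective e)))
    , (λ y → let (x , σx≡) = surj (t y)
             in t x , trans (cong (t ∘ σ) (t-involutive x)) (trans (cong t σx≡) (t-involutive y))) )
    , (λ x e → fpf (t x) (move e))

  conjugate-cong : {σ τ : Endo m} → σ ≗ τ → conjugate σ ≗ conjugate τ
  conjugate-cong σ≗τ x = cong t (σ≗τ (t x))

  conjugate-involutive : (σ : Endo m) → conjugate (conjugate σ) ≗ σ
  conjugate-involutive σ x = trans (t-involutive _) (cong σ (t-involutive x))

swap₀₁ : Endo (2 + k)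
swap₀₁ 0F            = 1F
swap₀₁ 1F            = 0F
swap₀₁ (suc (suc x)) = suc (suc x)

swap₀₁-involutive : (x : Fin (2 + k)) → swap₀₁ (swap₀₁ x) ≡ x
swap₀₁-involutive 0F            = refl
swap₀₁-involutive 1F            = refl
swap₀₁-involutive (suc (suc x)) = refl

OneToZeroOnly : Pred (Endo (2 + k)) 0ℓ
OneToZeroOnly = (IsDerangement ∩ ∁ (Maps 0F 1F)) ∩ Maps 1F 0F

oneToZeroOnly? : Decidable (OneToZeroOnly {k})
oneToZeroOnly? = (derangement? ∩? ∁? (maps? 0F 1F)) ∩? maps? 1F 0F

count-oneToZeroOnly : ∀ k → count oneToZeroOnly? (allFuns (2 + k) (2 + k))
                          ≡ count zeroToOneOnly? (allFuns (2 + k) (2 + k))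
count-oneToZeroOnly k =
  count-correspondence
    (∩-respects (∩-respects derangement-respects (∁-respects (maps-respects 0F 1F)))
                (maps-respects 1F 0F))
    (∩-respects (∩-respects derangement-respects (maps-respects 0F 1F))
                (∁-respects (maps-respects 1F 0F)))
    correspondence oneToZeroOnly? zeroToOneOnly?
  where
  open Conjugation {t = swap₀₁} swap₀₁-involutive
  correspondence : Correspondence (OneToZeroOnly {k}) (ZeroToOneOnly {k})
  correspondence = record
    { to             = conjugate
    ; from           = conjugate
    ; to-cong        = conjugate-cong
    ; from-cong      = conjugate-cong
    ; to-preserves   = λ _ ((der , σ0≢1) , σ1≡0) →
        (conjugate-derangement der , cong swap₀₁ σ1≡0) , (λ e → σ0≢1 (move e))
    ; from-preserves = λ _ ((der , σ0≡1) , σ1≢0) →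
        (conjugate-derangement der , (λ e → σ1≢0 (move e))) , cong swap₀₁ σ0≡1
    ; from∘to        = λ σ _ → conjugate-involutive σ
    ; to∘from        = λ σ _ → conjugate-involutive σ
    }

AvoidsZeroOne : Pred (Endo (2 + k)) 0ℓ
AvoidsZeroOne = (IsDerangement ∩ ∁ (Maps 0F 1F)) ∩ ∁ (Maps 1F 0F)

avoidsZeroOne? : Decidable (AvoidsZeroOne {k})
avoidsZeroOne? = (derangement? ∩? ∁? (maps? 0F 1F)) ∩? ∁? (maps? 1F 0F)

derangement-recurrence : ∀ k →
  d (2 + k) ≡ (d k + d (1 + k)) + (d (1 + k) + count avoidsZeroOne? (allFuns (2 + k) (2 + k)))
derangement-recurrence k = begin
  d (2 + k)
    ≡⟨ d≡count (2 + k) ⟩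
  count derangement? X
    ≡⟨ count-split derangement? (maps? 0F 1F) X ⟩
  count (derangement? ∩? maps? 0F 1F) X + count (derangement? ∩? ∁? (maps? 0F 1F)) X
    ≡⟨ cong₂ _+_ (count-split _ (maps? 1F 0F) X) (count-split _ (maps? 1F 0F) X) ⟩
  (count swapsZeroOne? X + count zeroToOneOnly? X) + (count oneToZeroOnly? X + count avoidsZeroOne? X)
    ≡⟨ cong₂ _+_ (cong₂ _+_ (count-swapsZeroOne k) (count-zeroToOneOnly k))
                 (cong (_+ count avoidsZeroOne? X)
                       (trans (count-oneToZeroOnly k) (count-zeroToOneOnly k))) ⟩
  (d k + d (1 + k)) + (d (1 + k) + count avoidsZeroOne? X)
    ∎
  where
  open ≡-Reasoning
  X : List (Endo (2 + k))
  X = allFuns (2 + k) (2 + k)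

block-ones : ∀ m (b : Fin (sum (replicate m 1))) → block (replicate m 1) b ≡ toℕ b
block-ones (suc m) 0F      = refl
block-ones (suc m) (suc b) = cong suc (block-ones m b)

sum-ones : ∀ m → sum (replicate m 1) ≡ m
sum-ones zero    = refl
sum-ones (suc m) = cong suc (sum-ones m)

different-blocks : ∀ m (x y : Fin (sum (2 ∷ replicate m 1))) →
  y ≢ x → (x ≡ 0F → y ≢ 1F) → (x ≡ 1F → y ≢ 0F) →
  block (2 ∷ replicate m 1) y ≢ block (2 ∷ replicate m 1) x
different-blocks m 0F            0F            y≢x _   _   _  = y≢x refl
different-blocks m 0F            1F            _   x≡0 _   _  = x≡0 refl refl
different-blocks m 1F            0F            _   _   x≡1 _  = x≡1 refl refl
different-blocks m 1F            1F            y≢x _   _   _  = y≢x refl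
different-blocks m 0F            (suc (suc y)) _   _   _   ()
different-blocks m 1F            (suc (suc y)) _   _   _   ()
different-blocks m (suc (suc x)) 0F            _   _   _   ()
different-blocks m (suc (suc x)) 1F            _   _   _   ()
different-blocks m (suc (suc x)) (suc (suc y)) y≢x _   _   e  =
  y≢x (cong (2 ↑ʳ_) (toℕ-injective
    (trans (sym (block-ones m y)) (trans (ℕ-suc-injective e) (block-ones m x)))))

P≡countAvoidsZeroOne : ∀ m →
  P (2 ∷ replicate m 1) ≡ count avoidsZeroOne? (allFuns (sum (2 ∷ replicate m 1)) (sum (2 ∷ replicate m 1)))
P≡countAvoidsZeroOne m =
  trans (length-filter≡count _ X) (count-cong _ avoidsZeroOne? isGD⇒avoids avoids⇒isGD X)
  where
  ts : List ℕ
  ts = 2 ∷ replicate m 1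
  X : List (Endo (sum ts))
  X = allFuns (sum ts) (sum ts)
  isGD⇒avoids : ∀ σ → IsPerm σ × IsGD ts σ → AvoidsZeroOne σ
  isGD⇒avoids σ (perm , gd) =
    ((perm , λ x σx≡x → gd x (cong (block ts) σx≡x)) , λ σ0≡1 → gd 0F (cong (block ts) σ0≡1))
    , λ σ1≡0 → gd 1F (cong (block ts) σ1≡0)
  avoids⇒isGD : ∀ σ → AvoidsZeroOne σ → IsPerm σ × IsGD ts σ
  avoids⇒isGD σ (((perm , fpf) , σ0≢1) , σ1≢0) =
    perm , λ x → different-blocks m x (σ x) (fpf x) (λ { refl → σ0≢1 }) (λ { refl → σ1≢0 })

P-recurrence : ∀ m →
  d (2 + m) ≡ (d m + d (1 + m)) + (d (1 + m) + P (2 ∷ replicate m 1))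
P-recurrence m =
  subst (λ k → d (2 + k) ≡ (d k + d (1 + k)) + (d (1 + k) + P (2 ∷ replicate m 1)))
        (sum-ones m)
        (trans (derangement-recurrence N)
               (cong (λ p → (d N + d (1 + N)) + (d (1 + N) + p)) (sym (P≡countAvoidsZeroOne m))))
  where
  N : ℕ
  N = sum (replicate m 1)

-- ℤ's prefix +_ clashes with sections (x +_) of ℕ addition, so the integer
-- vocabulary needed for the statement is imported only here.
open import Data.Integer as ℤ using (ℤ; +_; _-_; _*_)
open import Data.Integer.Properties using (pos-+)
open import Data.Integer.Tactic.RingSolver using (solve-∀)

solve-recurrence : ∀ d₀ d₁ d₂ p → d₂ ≡ (d₀ + d₁) + (d₁ + p) → + p ≡ + d₂ - (+ 2) * (+ d₁) - + d₀
solve-recurrence d₀ d₁ d₂ p refl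
  rewrite pos-+ (d₀ + d₁) (d₁ + p) | pos-+ d₀ d₁ | pos-+ d₁ p = identity (+ d₀) (+ d₁) (+ p)
  where
  identity : ∀ (a b c : ℤ) → c ≡ (a ℤ.+ b ℤ.+ (b ℤ.+ c)) - (+ 2) * b - a
  identity = solve-∀

lemma2p1 : (n : ℕ) → 2 ≤ n →
    + P (2 ∷ replicate (n ∸ 2) 1) ≡ + d n - (+ 2) * (+ d (n ∸ 1)) - + d (n ∸ 2)
lemma2p1 (suc (suc m)) (s≤s (s≤s _)) =
  solve-recurrence (d m) (d (1 + m)) (d (2 + m)) (P (2 ∷ replicate m 1)) (P-recurrence m)
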